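{- Let $W\in AW(n,d)$. Any two perfect orientations of $W$ can be transformed into each other by a sequence of swivel moves followed by a reordering of the sink vertices (i.e. a change of the bijection $f_{\mathcal{O}}$).
   Context: A normal plabic graph is a planar graph embedded in a closed disk (loops/multiple edges allowed) with $n$ boundary vertices labelled $1,\dots,n$ clockwise, each incident to exactly one edge, and interior vertices coloured black or white, such that white vertices have degree $3$, boundary vertices are adjacent only to black vertices, and no edge joins two interior vertices of the same colour. An augmented web is one with no interior face (not meeting the boundary circle) of degree $<6$ and no black vertex of degree $<3$; its exceedance is #black − #white; $AW(n,d)$ is the set of augmented webs with $n$ boundary vertices and exceedance $d$. A perfect orientation $\mathcal{O}$ is an orientation of every edge such that boundary edges point away from the boundary, each interior white vertex has exactly one incoming edge, each interior black vertex has at most one outgoing edge, and from every vertex there is a directed path to a sink (black vertex with no outgoing edge), together with a bijection $f_{\mathcal{O}}$ from the set of sinks to $\{1,\dots,d\}$. A swivel move at a white vertex $v$ reverses exactly one incoming and one outgoing edge at $v$, these two edges joining $v$ to distinct black vertices, yielding again a perfect orientation; this removes one sink and creates one sink, and the new sink is given the same position in the total order as the removed one. -}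

module Defs where

open import Data.Nat using (ℕ; zero; suc; _+_; _*_; _≤_; _≤ᵇ_; _≡ᵇ_)
open import Data.Nat.DivMod using (_mod_)
open import Data.Fin using (Fin; toℕ) renaming (zero to fzero; suc to fsuc)
open import Data.Fin.Properties using () renaming (_≟_ to _≟F_)
open import Data.Bool using (Bool; true; false; not; _∧_; _∨_; if_then_else_; T)
open import Data.Product using (Σ; _×_; _,_)
open import Data.Sum using (_⊎_)
open import Relation.Nullary using (¬_; does)
open import Relation.Binary.PropositionalEquality using (_≡_; _≢_)
open import Relation.Binary.Construct.Closure.ReflexiveTransitive using (Star)
open import Function using (_∘_)
open import Function.Bundles using (_⤖_; Bijection)

iter : ∀ {A : Set} → (A → A) → ℕ → A → A
iter f zero x = x
iter f (suc k) x = f (iter f k x)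

count : ∀ {D} → (Fin D → Bool) → ℕ
count {zero} p = 0
count {suc D} p = (if p fzero then 1 else 0) + count (p ∘ fsuc)

allB : ∀ {D} → (Fin D → Bool) → Bool
allB {zero} p = true
allB {suc D} p = p fzero ∧ allB (p ∘ fsuc)

cycleMin : ∀ {D} → (Fin D → Fin D) → Fin D → Bool
cycleMin {D} π x = allB (λ (k : Fin D) → toℕ x ≤ᵇ toℕ (iter π (toℕ k) x))

numCycles : ∀ {D} → (Fin D → Fin D) → ℕ
numCycles π = count (cycleMin π)

next : ∀ {n} → Fin n → Fin n
next {suc m} i = suc (toℕ i) mod suc m

data Vtx (n B W : ℕ) : Set where
  bnd : Fin n → Vtx n B W
  blk : Fin B → Vtx n B W
  wht : Fin W → Vtx n B W

module _ {n B W : ℕ} where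
  isBnd isBlack isWhite : Vtx n B W → Bool
  isBnd (bnd _) = true
  isBnd _ = false
  isBlack (blk _) = true
  isBlack _ = false
  isWhite (wht _) = true
  isWhite _ = false

  sameVtx : Vtx n B W → Vtx n B W → Bool
  sameVtx (bnd i) (bnd j) = does (i ≟F j)
  sameVtx (blk i) (blk j) = does (i ≟F j)
  sameVtx (wht i) (wht j) = does (i ≟F j)
  sameVtx _ _ = false

-- Normal plabic graphs, encoded as combinatorial maps.
-- Darts (half-edges) are Fin D; α pairs the two darts of an edge; σ is the
-- counterclockwise rotation of darts around each interior vertex, and on the
-- boundary darts it is b_i ↦ b_{i+1}  (the boundary circle collapsed to one
-- point, so that the disk becomes a sphere). Faces are the cycles of σ ∘ α.

record PlabicGraph (n : ℕ) : Set where
  field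
    B W D   : ℕ
    vtx     : Fin D → Vtx n B W
    α σ σ⁻  : Fin D → Fin D
    α-invol : ∀ x → α (α x) ≡ x
    α-nofix : ∀ x → α x ≢ x
    σ-left  : ∀ x → σ⁻ (σ x) ≡ x
    σ-right : ∀ x → σ (σ⁻ x) ≡ x
    -- rotation systems at interior vertices: σ-cycles = darts of a vertex
    σ-vtx   : ∀ x → isBnd (vtx x) ≡ false → vtx (σ x) ≡ vtx x
    σ-trans : ∀ x y → isBnd (vtx x) ≡ false → vtx x ≡ vtx y →
              Σ ℕ (λ k → iter σ k x ≡ y)
    bdart   : Fin n → Fin D
    bdart-v : ∀ i → vtx (bdart i) ≡ bnd i
    bdart-u : ∀ x i → vtx x ≡ bnd i → x ≡ bdart i
    -- boundary vertices are in clockwise order 1..n on the circle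
    σ-bnd   : ∀ i → σ (bdart i) ≡ bdart (next i)
    bnd-blk : ∀ i → isBlack (vtx (α (bdart i))) ≡ true
    wht-blk : ∀ x → isWhite (vtx x) ≡ true → isBlack (vtx (α x)) ≡ true
    blk-blk : ∀ x → isBlack (vtx x) ≡ true → isBlack (vtx (α x)) ≡ false
    wht-deg : ∀ w → count (λ x → sameVtx (vtx x) (wht w)) ≡ 3
    conn    : ∀ x y → Star (λ u v → (v ≡ α u) ⊎ (v ≡ σ u)) x y
    -- planarity (genus 0): V − E + F = 2, i.e. 2V + 2F = 4 + D
    planar  : (D ≡ 0) ⊎
              (2 * (numCycles σ + numCycles (σ ∘ α)) ≡ 4 + D)

  φ : Fin D → Fin D
  φ = σ ∘ α

  deg : Vtx n B W → ℕ
  deg v = count (λ x → sameVtx (vtx x) v)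

  InteriorFace : Fin D → Set
  InteriorFace x = ∀ k → isBnd (vtx (iter φ k x)) ≡ false

  SmallFace : Fin D → Set
  SmallFace x = Σ ℕ λ k → (1 ≤ k) × (k ≤ 5) × (iter φ k x ≡ x)

open PlabicGraph public

record AugmentedWeb {n : ℕ} (G : PlabicGraph n) (d : ℕ) : Set where
  field
    exceedance : B G ≡ d + W G
    noSmallFace : ∀ x → InteriorFace G x → ¬ SmallFace G x
    blackDeg : ∀ b → 3 ≤ deg G (blk b)

-- Perfect orientations.  out x = true means the edge of dart x is oriented
-- away from the vertex vtx x.

module _ {n : ℕ} (G : PlabicGraph n) where

  isSink : (Fin (D G) → Bool) → Fin (B G) → Bool
  isSink out b = count (λ x → sameVtx (vtx G x) (blk b) ∧ out x) ≡ᵇ 0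

  Sink : (Fin (D G) → Bool) → Set
  Sink out = Σ (Fin (B G)) (λ b → T (isSink out b))

  data Reaches (out : Fin (D G) → Bool) : Vtx n (B G) (W G) → Set where
    here : ∀ b → T (isSink out b) → Reaches out (blk b)
    step : ∀ x v → vtx G x ≡ v → out x ≡ true →
           Reaches out (vtx G (α G x)) → Reaches out v

  record PerfectOrientation (d : ℕ) : Set where
    field
      out     : Fin (D G) → Bool
      out-α   : ∀ x → out (α G x) ≡ not (out x)
      out-bnd : ∀ i → out (bdart G i) ≡ true
      white-in  : ∀ w → count (λ x → sameVtx (vtx G x) (wht w) ∧ not (out x)) ≡ 1
      black-out : ∀ b → count (λ x → sameVtx (vtx G x) (blk b) ∧ out x) ≤ 1
      reach   : ∀ v → Reaches out v
      label   : Sink out ⤖ Fin d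
  open PerfectOrientation public

  labelOf : ∀ {d} (P : PerfectOrientation d) → Sink (out P) → Fin d
  labelOf P s = Bijection.to (label P) s

  -- swivel move at a white vertex w, reversing the incoming edge (dart x₁ at w)
  -- and the outgoing edge (dart x₂ at w); the new sink (other end b₁ of x₁)
  -- takes the label of the removed sink (other end b₂ of x₂).
  Swivel : ∀ {d} → PerfectOrientation d → PerfectOrientation d → Set
  Swivel P Q =
    Σ (Fin (W G)) λ w → Σ (Fin (D G)) λ x₁ → Σ (Fin (D G)) λ x₂ →
      (vtx G x₁ ≡ wht w) × (vtx G x₂ ≡ wht w) ×
      (out P x₁ ≡ false) × (out P x₂ ≡ true) ×
      (vtx G (α G x₁) ≢ vtx G (α G x₂)) ×
      (∀ y → out Q y ≡
        (if (does (y ≟F x₁) ∨ does (y ≟F α G x₁) ∨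
             does (y ≟F x₂) ∨ does (y ≟F α G x₂))
         then not (out P y) else out P y)) ×
      (∀ b₁ b₂ → vtx G (α G x₁) ≡ blk b₁ → vtx G (α G x₂) ≡ blk b₂ →
        (∀ p q → labelOf Q (b₁ , p) ≡ labelOf P (b₂ , q)) ×
        (∀ b → b ≢ b₁ → ∀ p q → labelOf Q (b , p) ≡ labelOf P (b , q)))

  SameOrientation : ∀ {d} → PerfectOrientation d → PerfectOrientation d → Set
  SameOrientation P Q = ∀ y → out P y ≡ out Q y

-- Identify a perfect orientation with the set of darts pointing away from their vertex; a swivel
-- at a white vertex w toggles the four darts of two edges at w. Induct on the number δ(P, Q) of
-- darts where P and Q disagree. If some black b is a sink of P but not of Q, the Q-edge leaving b
-- enters a white w, and swivelling P at w onto the sink b makes P agree with Q on both edges it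
-- touches; a sink of Q but not of P is handled by the same swivel on Q, which is reversible.
-- If P and Q have the same sinks, follow a loop-erased P-directed path from a black vertex where
-- they disagree to a sink: past the last hop whose black edge Q reverses, the path is Q-directed
-- too. Reversing this path in P, and in Q the same path entered through Q's incoming edge at that
-- hop, by swivels from the sink backwards, flips both orientations alike except on the two
-- incoming edges of that white vertex, where they come to agree.

module Submission where

open import Defs
open import Data.Nat using (ℕ; zero; suc; _+_; _≤_; _<_; z≤n; s≤s)
open import Data.Nat.Induction using (<-wellFounded)
open import Data.Nat.Properties
  using (≤-reflexive; ≤-trans; ≤-<-trans; ≤-pred; m≤n⇒m≤1+n; m<n⇒m<1+n; n≢0⇒n>0; <⇒≱; 0≢1+n; ≡ᵇ⇒≡; ≡⇒≡ᵇ)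
open import Data.Fin using (Fin) renaming (zero to fzero; suc to fsuc)
open import Data.Fin.Properties using (any?; all?; ¬∀⟶∃¬; suc-injective) renaming (_≟_ to _≟F_)
open import Data.Bool using (Bool; true; false; not; _∧_; _∨_; _xor_; if_then_else_; T)
open import Data.Bool.Properties
  using ( ¬-not; not-injective; not-involutive; ⇔→≡; T-irrelevant
        ; not-distribˡ-xor; not-distribʳ-xor; xor-annihilates-not; xor-assoc; xor-comm; xor-same; xor-identityʳ)
  renaming (_≟_ to _≟B_)
open import Data.Product using (Σ; ∃; _×_; _,_; proj₁; proj₂)
open import Data.Sum using (_⊎_; inj₁; inj₂; [_,_]′)
open import Data.Empty using (⊥)
open import Data.Unit using (⊤; tt)
open import Data.List using (List; []; _∷_)
open import Data.List.Relation.Unary.Any as Any using (Any; here; there)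
open import Data.List.Membership.Propositional using (_∈_; _∉_)
open import Relation.Nullary using (¬_; Dec; does; yes; no; contradiction)
open import Relation.Nullary.Decidable using (dec-true; toSum)
open import Relation.Binary.PropositionalEquality
  using (_≡_; _≢_; refl; sym; trans; cong; cong₂; subst; subst₂; module ≡-Reasoning)
open import Relation.Binary.Construct.Closure.ReflexiveTransitive using (Star; ε; _◅_; _◅◅_)
open import Induction.WellFounded using (Acc; acc)
open import Function using (_∘_; id)
open import Function.Bundles using (mk⇔; mk↔ₛ′)
open import Function.Properties.Inverse using (↔⇒⤖)
open import Function.Construct.Composition using (_⤖-∘_)

≡true⇒≢false : ∀ {b} → b ≡ true → b ≢ false
≡true⇒≢false refl ()

true≢false : true ≢ false
true≢false ()

does≡true⇒ : ∀ {A : Set} (a? : Dec A) → does a? ≡ true → A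
does≡true⇒ (yes a) _ = a

if-not≡xor : ∀ s b → (if s then not b else b) ≡ s xor b
if-not≡xor true  b = refl
if-not≡xor false b = refl

xor-cancelˡ : ∀ s b → s xor (s xor b) ≡ b
xor-cancelˡ true  b = not-involutive b
xor-cancelˡ false b = refl

xor-interchange : ∀ a b c e → (a xor b) xor (c xor e) ≡ (a xor c) xor (b xor e)
xor-interchange false b false e = refl
xor-interchange false b true  e = sym (not-distribʳ-xor b e)
xor-interchange true  b false e = sym (not-distribˡ-xor b e)
xor-interchange true  b true  e = xor-annihilates-not b e

xor-cancel-common : ∀ a b c → (a xor c) xor (b xor c) ≡ a xor b
xor-cancel-common a b c =
  trans (xor-interchange a c b c) (trans (cong ((a xor b) xor_) (xor-same c)) (xor-identityʳ (a xor b)))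

xor≡true⇒ : ∀ {a b} → a xor b ≡ true → a ≡ true ⊎ b ≡ true
xor≡true⇒ {true}  _ = inj₁ refl
xor≡true⇒ {false} e = inj₂ e

xor-shrinks : ∀ {t r} → (t ≡ true → r ≡ true) → t xor r ≡ true → r ≡ true
xor-shrinks {false} _ e = e
xor-shrinks {true}  h e = contradiction (h refl) λ r≡true → ≡true⇒≢false e (cong not r≡true)

bools-differ : ∀ {a c} → a ≢ c → (T a × ¬ T c) ⊎ (¬ T a × T c)
bools-differ {true}  {true}  a≢c = contradiction refl a≢c
bools-differ {true}  {false} _   = inj₁ (tt , λ ())
bools-differ {false} {true}  _   = inj₂ ((λ ()) , tt)
bools-differ {false} {false} a≢c = contradiction refl a≢c

count-cong : ∀ {D} {p q : Fin D → Bool} → (∀ a → p a ≡ q a) → count p ≡ count q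
count-cong {zero} h = refl
count-cong {suc D} h rewrite h fzero = cong (_ +_) (count-cong (h ∘ fsuc))

count≡0⇒ : ∀ {D} {p : Fin D → Bool} → count p ≡ 0 → ∀ a → p a ≡ false
count≡0⇒ {suc D} {p} h a with p fzero in e
count≡0⇒ {suc D} h fzero    | false = e
count≡0⇒ {suc D} h (fsuc a) | false = count≡0⇒ h a

count≡0⇐ : ∀ {D} {p : Fin D → Bool} → (∀ a → p a ≡ false) → count p ≡ 0
count≡0⇐ {zero} h = refl
count≡0⇐ {suc D} h rewrite h fzero = count≡0⇐ (h ∘ fsuc)

count>0 : ∀ {D} (p : Fin D → Bool) {a} → p a ≡ true → 0 < count p
count>0 p pa = n≢0⇒n>0 λ c → ≡true⇒≢false pa (count≡0⇒ {p = p} c _)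

count≡1 : ∀ {D} {p : Fin D → Bool} a → p a ≡ true → (∀ b → b ≢ a → p b ≡ false) → count p ≡ 1
count≡1 {suc D} fzero pa h rewrite pa = cong suc (count≡0⇐ λ b → h (fsuc b) λ ())
count≡1 {suc D} (fsuc a) pa h rewrite h fzero (λ ()) =
  count≡1 a pa λ b b≢a → h (fsuc b) (b≢a ∘ suc-injective)

count≤1⇒unique : ∀ {D} {p : Fin D → Bool} → count p ≤ 1 → ∀ {a b} → p a ≡ true → p b ≡ true → a ≡ b
count≤1⇒unique {suc D} {p} h {a} {b} pa pb with p fzero in e
count≤1⇒unique h {fzero}  {fzero}  pa pb | _     = refl
count≤1⇒unique {p = p} h {fzero}  {fsuc b} pa pb | true  = contradiction (≤-pred h) (<⇒≱ (count>0 (p ∘ fsuc) pb))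
count≤1⇒unique {p = p} h {fsuc a} {_}      pa pb | true  = contradiction (≤-pred h) (<⇒≱ (count>0 (p ∘ fsuc) pa))
count≤1⇒unique h {fzero}  {_}      pa pb | false = contradiction e (≡true⇒≢false pa)
count≤1⇒unique h {fsuc a} {fzero}  pa pb | false = contradiction e (≡true⇒≢false pb)
count≤1⇒unique h {fsuc a} {fsuc b} pa pb | false = cong fsuc (count≤1⇒unique h pa pb)

count≢0⇒∃ : ∀ {D} {p : Fin D → Bool} → count p ≢ 0 → ∃ λ a → p a ≡ true
count≢0⇒∃ {p = p} h with any? (λ a → p a ≟B true)
... | yes found = found
... | no none = contradiction (count≡0⇐ λ a → ¬-not λ pa → none (a , pa)) h

count-mono : ∀ {D} {p q : Fin D → Bool} → (∀ a → p a ≡ true → q a ≡ true) → count p ≤ count q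
count-mono {zero} h = z≤n
count-mono {suc D} {p} {q} h with p fzero in ep | q fzero in eq
... | true  | true  = s≤s (count-mono (h ∘ fsuc))
... | true  | false = contradiction eq (≡true⇒≢false (h fzero ep))
... | false | true  = m≤n⇒m≤1+n (count-mono (h ∘ fsuc))
... | false | false = count-mono (h ∘ fsuc)

count-mono-< : ∀ {D} {p q : Fin D → Bool} → (∀ a → p a ≡ true → q a ≡ true) →
               ∀ a → p a ≡ false → q a ≡ true → count p < count q
count-mono-< {suc D} {p} {q} h a pa qa with p fzero in ep | q fzero in eq
... | true  | false = contradiction eq (≡true⇒≢false (h fzero ep))
count-mono-< h fzero    pa qa | true  | true  = contradiction pa (≡true⇒≢false ep)
count-mono-< h (fsuc a) pa qa | true  | true  = s≤s (count-mono-< (h ∘ fsuc) a pa qa)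
count-mono-< h fzero    pa qa | false | true  = s≤s (count-mono (h ∘ fsuc))
count-mono-< h (fsuc a) pa qa | false | true  = m<n⇒m<1+n (count-mono-< (h ∘ fsuc) a pa qa)
count-mono-< h fzero    pa qa | false | false = contradiction eq (≡true⇒≢false qa)
count-mono-< h (fsuc a) pa qa | false | false = count-mono-< (h ∘ fsuc) a pa qa

-- Since p′ ⊕ q′ = (s₁ ⊕ s₂) ⊕ (p ⊕ q), the disagreement set of p and q loses s₁ ⊕ s₂ ∋ a.
count-flips-< : ∀ {D} {p q p′ q′ s₁ s₂ : Fin D → Bool} →
                (∀ z → p′ z ≡ s₁ z xor p z) → (∀ z → q′ z ≡ s₂ z xor q z) →
                (∀ z → s₁ z xor s₂ z ≡ true → p z xor q z ≡ true) →
                ∀ a → s₁ a xor s₂ a ≡ true →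
                count (λ z → p′ z xor q′ z) < count (λ z → p z xor q z)
count-flips-< {p = p} {q} {p′} {q′} {s₁} {s₂} p′≡ q′≡ inside a flips-a =
  ≤-<-trans (≤-reflexive (count-cong rearranged))
            (count-mono-< {p = λ z → (s₁ z xor s₂ z) xor (p z xor q z)}
                          (λ z → xor-shrinks (inside z)) a at-a (inside a flips-a))
  where
  rearranged : ∀ z → p′ z xor q′ z ≡ (s₁ z xor s₂ z) xor (p z xor q z)
  rearranged z = trans (cong₂ _xor_ (p′≡ z) (q′≡ z)) (xor-interchange (s₁ z) (p z) (s₂ z) (q z))
  at-a : (s₁ a xor s₂ a) xor (p a xor q a) ≡ false
  at-a rewrite flips-a | inside a flips-a = refl

blk-injective : ∀ {n B W} {a b : Fin B} → blk {n} {B} {W} a ≡ blk b → a ≡ b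
blk-injective refl = refl

wht-injective : ∀ {n B W} {a b : Fin W} → wht {n} {B} {W} a ≡ wht b → a ≡ b
wht-injective refl = refl

sameVtx⇒≡ : ∀ {n B W} {u v : Vtx n B W} → sameVtx u v ≡ true → u ≡ v
sameVtx⇒≡ {u = bnd i} {bnd j} h = cong bnd (does≡true⇒ (i ≟F j) h)
sameVtx⇒≡ {u = blk i} {blk j} h = cong blk (does≡true⇒ (i ≟F j) h)
sameVtx⇒≡ {u = wht i} {wht j} h = cong wht (does≡true⇒ (i ≟F j) h)
sameVtx⇒≡ {u = bnd _} {blk _} ()
sameVtx⇒≡ {u = bnd _} {wht _} ()
sameVtx⇒≡ {u = blk _} {bnd _} ()
sameVtx⇒≡ {u = blk _} {wht _} ()
sameVtx⇒≡ {u = wht _} {bnd _} ()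
sameVtx⇒≡ {u = wht _} {blk _} ()

sameVtx-refl : ∀ {n B W} (v : Vtx n B W) → sameVtx v v ≡ true
sameVtx-refl (bnd i) = dec-true (i ≟F i) refl
sameVtx-refl (blk i) = dec-true (i ≟F i) refl
sameVtx-refl (wht i) = dec-true (i ≟F i) refl

blackEndOf : ∀ {n B W} → Vtx n B W → Vtx n B W → Vtx n B W
blackEndOf (blk b) _ = blk b
blackEndOf (bnd _) u = u
blackEndOf (wht _) u = u

module AtVertex {D n B W : ℕ} (vtx : Fin D → Vtx n B W) (v : Vtx n B W) where

  at : (Fin D → Bool) → Fin D → Bool
  at p x = sameVtx (vtx x) v ∧ p x

  at-here : ∀ p {x} → vtx x ≡ v → at p x ≡ p x
  at-here p e rewrite e | sameVtx-refl v = refl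

  at-cases : ∀ p x → (vtx x ≡ v × at p x ≡ p x) ⊎ at p x ≡ false
  at-cases p x with sameVtx (vtx x) v in e
  ... | true  = inj₁ (sameVtx⇒≡ e , refl)
  ... | false = inj₂ refl

  none-at⇒ : ∀ {p} → count (at p) ≡ 0 → ∀ x → vtx x ≡ v → p x ≡ false
  none-at⇒ {p} h x e = trans (sym (at-here p e)) (count≡0⇒ h x)

  none-at⇐ : ∀ {p} → (∀ x → vtx x ≡ v → p x ≡ false) → count (at p) ≡ 0
  none-at⇐ {p} h = count≡0⇐ λ x → [ (λ (e , eq) → trans eq (h x e)) , id ]′ (at-cases p x)

  one-at : ∀ {p} a → vtx a ≡ v → p a ≡ true → (∀ x → vtx x ≡ v → x ≢ a → p x ≡ false) →
           count (at p) ≡ 1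
  one-at {p} a e pa h = count≡1 a (trans (at-here p e) pa) others
    where
    others : ∀ x → x ≢ a → at p x ≡ false
    others x x≢a = [ (λ (ex , eq) → trans eq (h x ex x≢a)) , id ]′ (at-cases p x)

  unique-at : ∀ {p x y} → count (at p) ≤ 1 → vtx x ≡ v → vtx y ≡ v → p x ≡ true → p y ≡ true → x ≡ y
  unique-at {p} h ex ey px py = count≤1⇒unique h (trans (at-here p ex) px) (trans (at-here p ey) py)

  some-at : ∀ {p} → count (at p) ≢ 0 → ∃ λ x → vtx x ≡ v × p x ≡ true
  some-at {p} h with count≢0⇒∃ h
  ... | x , atx with at-cases p x
  ...   | inj₁ (e , eq) = x , e , trans (sym eq) atx
  ...   | inj₂ f        = contradiction f (≡true⇒≢false atx)

  count-at-cong : ∀ {p q} → (∀ x → vtx x ≡ v → p x ≡ q x) → count (at p) ≡ count (at q)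
  count-at-cong {p} {q} h = count-cong at-cong
    where
    at-cong : ∀ x → at p x ≡ at q x
    at-cong x with sameVtx (vtx x) v in e
    ... | true  = h x (sameVtx⇒≡ e)
    ... | false = refl

module Swivels {n : ℕ} (G : PlabicGraph n) where

  Dart Black White : Set
  Dart  = Fin (D G)
  Black = Fin (B G)
  White = Fin (W G)

  α-injective : ∀ {x y : Dart} → α G x ≡ α G y → x ≡ y
  α-injective {x} {y} e = trans (sym (α-invol G x)) (trans (cong (α G) e) (α-invol G y))

  white-end : ∀ {x w} → vtx G x ≡ wht w → ∃ λ b → vtx G (α G x) ≡ blk b
  white-end {x} e with vtx G (α G x) | wht-blk G x (cong isWhite e)
  ... | blk b | _  = b , refl
  ... | bnd _ | ()
  ... | wht _ | ()

  isSink⇒ : ∀ {o b} → T (isSink G o b) → ∀ x → vtx G x ≡ blk b → o x ≡ false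
  isSink⇒ {o} {b} s = AtVertex.none-at⇒ (vtx G) (blk b) (≡ᵇ⇒≡ _ 0 s)

  isSink⇐ : ∀ {o b} → (∀ x → vtx G x ≡ blk b → o x ≡ false) → T (isSink G o b)
  isSink⇐ {o} {b} h = ≡⇒≡ᵇ _ 0 (AtVertex.none-at⇐ (vtx G) (blk b) h)

  module _ {d} (P : PerfectOrientation G d) where

    out-α≡ : ∀ {x b} → out P x ≡ b → out P (α G x) ≡ not b
    out-α≡ {x} e = trans (out-α P x) (cong not e)

    out-at-bnd : ∀ {x i} → vtx G x ≡ bnd i → out P x ≡ true
    out-at-bnd {x} {i} e = trans (cong (out P) (bdart-u G x i e)) (out-bnd P i)

    out-unique : ∀ {b x y} → vtx G x ≡ blk b → vtx G y ≡ blk b → out P x ≡ true → out P y ≡ true → x ≡ y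
    out-unique {b} = AtVertex.unique-at (vtx G) (blk b) (black-out P b)

    in-unique : ∀ {w x y} → vtx G x ≡ wht w → vtx G y ≡ wht w → out P x ≡ false → out P y ≡ false → x ≡ y
    in-unique {w} ex ey ox oy =
      AtVertex.unique-at (vtx G) (wht w) (≤-reflexive (white-in P w)) ex ey (cong not ox) (cong not oy)

    in-at : ∀ w → ∃ λ x → vtx G x ≡ wht w × out P x ≡ false
    in-at w with AtVertex.some-at (vtx G) (wht w) {not ∘ out P} (λ c → 0≢1+n (trans (sym c) (white-in P w)))
    ... | x , e , nx = x , e , not-injective nx

    black-out-end : ∀ {x b} → vtx G x ≡ blk b → out P x ≡ true → ∃ λ w → vtx G (α G x) ≡ wht w
    black-out-end {x} e ox with vtx G (α G x) in eα | blk-blk G x (cong isBlack e)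
    ... | wht w | _  = w , refl
    ... | blk _ | ()
    ... | bnd _ | _  = contradiction (out-α≡ ox) (≡true⇒≢false (out-at-bnd eα))

  swivelSet : Dart → Dart → Dart → Bool
  swivelSet x₁ x₂ y = does (y ≟F x₁) ∨ does (y ≟F α G x₁) ∨ does (y ≟F x₂) ∨ does (y ≟F α G x₂)

  module _ {x₁ x₂ : Dart} where

    swivelSet⇒ : ∀ {y} → swivelSet x₁ x₂ y ≡ true → y ≡ x₁ ⊎ y ≡ α G x₁ ⊎ y ≡ x₂ ⊎ y ≡ α G x₂
    swivelSet⇒ {y} h with y ≟F x₁ | y ≟F α G x₁ | y ≟F x₂ | y ≟F α G x₂
    ... | yes e | _     | _     | _     = inj₁ e
    ... | no _  | yes e | _     | _     = inj₂ (inj₁ e)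
    ... | no _  | no _  | yes e | _     = inj₂ (inj₂ (inj₁ e))
    ... | no _  | no _  | no _  | yes e = inj₂ (inj₂ (inj₂ e))

    swivelSet⇐ : ∀ {y} → y ≡ x₁ ⊎ y ≡ α G x₁ ⊎ y ≡ x₂ ⊎ y ≡ α G x₂ → swivelSet x₁ x₂ y ≡ true
    swivelSet⇐ {y} h with y ≟F x₁ | y ≟F α G x₁ | y ≟F x₂ | y ≟F α G x₂ | h
    ... | yes _ | _     | _     | _     | _                     = refl
    ... | no _  | yes _ | _     | _     | _                     = refl
    ... | no _  | no _  | yes _ | _     | _                     = refl
    ... | no _  | no _  | no _  | yes _ | _                     = refl
    ... | no ¬e | no _  | no _  | no _  | inj₁ e                = contradiction e ¬e
    ... | no _  | no ¬e | no _  | no _  | inj₂ (inj₁ e)         = contradiction e ¬e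
    ... | no _  | no _  | no ¬e | no _  | inj₂ (inj₂ (inj₁ e))  = contradiction e ¬e
    ... | no _  | no _  | no _  | no ¬e | inj₂ (inj₂ (inj₂ e))  = contradiction e ¬e

    swivelSet-α : ∀ y → swivelSet x₁ x₂ (α G y) ≡ swivelSet x₁ x₂ y
    swivelSet-α y = ⇔→≡ (mk⇔ (subst (λ z → swivelSet x₁ x₂ z ≡ true) (α-invol G y) ∘ closed) closed)
      where
      closed : ∀ {z} → swivelSet x₁ x₂ z ≡ true → swivelSet x₁ x₂ (α G z) ≡ true
      closed {z} h with swivelSet⇒ {z} h
      ... | inj₁ refl                = swivelSet⇐ (inj₂ (inj₁ refl))
      ... | inj₂ (inj₁ refl)         = swivelSet⇐ (inj₁ (α-invol G x₁))
      ... | inj₂ (inj₂ (inj₁ refl))  = swivelSet⇐ (inj₂ (inj₂ (inj₂ refl)))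
      ... | inj₂ (inj₂ (inj₂ refl))  = swivelSet⇐ (inj₂ (inj₂ (inj₁ (α-invol G x₂))))

  swivelSet-comm : ∀ x₁ x₂ y → swivelSet x₁ x₂ y ≡ swivelSet x₂ x₁ y
  swivelSet-comm x₁ x₂ y =
    ⇔→≡ (mk⇔ (swivelSet⇐ ∘ swap ∘ swivelSet⇒ {y = y}) (swivelSet⇐ ∘ swap ∘ swivelSet⇒ {y = y}))
    where
    swap : ∀ {a b} → y ≡ a ⊎ y ≡ α G a ⊎ y ≡ b ⊎ y ≡ α G b → y ≡ b ⊎ y ≡ α G b ⊎ y ≡ a ⊎ y ≡ α G a
    swap (inj₁ e)                = inj₂ (inj₂ (inj₁ e))
    swap (inj₂ (inj₁ e))         = inj₂ (inj₂ (inj₂ e))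
    swap (inj₂ (inj₂ (inj₁ e)))  = inj₁ e
    swap (inj₂ (inj₂ (inj₂ e)))  = inj₂ (inj₁ e)

  swivelSet-shared : ∀ {a a′ y z} → swivelSet a y z xor swivelSet a′ y z ≡ true →
                     (z ≡ a ⊎ z ≡ α G a) ⊎ (z ≡ a′ ⊎ z ≡ α G a′)
  swivelSet-shared {a} {a′} {y} {z} h with swivelSet a y z in e | swivelSet a′ y z in e′
  ... | true | false with swivelSet⇒ {a} {y} {z} e
  ...   | inj₁ z≡                = inj₁ (inj₁ z≡)
  ...   | inj₂ (inj₁ z≡)         = inj₁ (inj₂ z≡)
  ...   | inj₂ (inj₂ (inj₁ z≡))  = contradiction e′ (≡true⇒≢false (swivelSet⇐ (inj₂ (inj₂ (inj₁ z≡)))))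
  ...   | inj₂ (inj₂ (inj₂ z≡))  = contradiction e′ (≡true⇒≢false (swivelSet⇐ (inj₂ (inj₂ (inj₂ z≡)))))
  swivelSet-shared {a} {a′} {y} {z} h | false | true with swivelSet⇒ {a′} {y} {z} e′
  ...   | inj₁ z≡                = inj₂ (inj₁ z≡)
  ...   | inj₂ (inj₁ z≡)         = inj₂ (inj₂ z≡)
  ...   | inj₂ (inj₂ (inj₁ z≡))  = contradiction e (≡true⇒≢false (swivelSet⇐ (inj₂ (inj₂ (inj₁ z≡)))))
  ...   | inj₂ (inj₂ (inj₂ z≡))  = contradiction e (≡true⇒≢false (swivelSet⇐ (inj₂ (inj₂ (inj₂ z≡)))))

  sink-≡ : ∀ {o} {b b′ : Black} {s : T (isSink G o b)} {s′ : T (isSink G o b′)} →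
           b ≡ b′ → _≡_ {A = Sink G o} (b , s) (b′ , s′)
  sink-≡ refl = cong (_ ,_) (T-irrelevant _ _)

  module SwivelToSink {d} (P : PerfectOrientation G d) {w : White} {x₁ x₂ : Dart} {b₁ b₂ : Black}
      (x₁-at : vtx G x₁ ≡ wht w) (x₂-at : vtx G x₂ ≡ wht w)
      (x₁-in : out P x₁ ≡ false) (x₂-out : out P x₂ ≡ true)
      (b₁-end : vtx G (α G x₁) ≡ blk b₁) (b₂-end : vtx G (α G x₂) ≡ blk b₂)
      (b₁≢b₂ : b₁ ≢ b₂) where

    S : Dart → Bool
    S = swivelSet x₁ x₂

    S⇒ : ∀ {y} → S y ≡ true → y ≡ x₁ ⊎ y ≡ α G x₁ ⊎ y ≡ x₂ ⊎ y ≡ α G x₂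
    S⇒ {y} = swivelSet⇒ {x₁} {x₂} {y}

    S⇐ : ∀ {y} → y ≡ x₁ ⊎ y ≡ α G x₁ ⊎ y ≡ x₂ ⊎ y ≡ α G x₂ → S y ≡ true
    S⇐ {y} = swivelSet⇐ {x₁} {x₂} {y}

    out′ : Dart → Bool
    out′ y = S y xor out P y

    flipped : ∀ {y} → S y ≡ true → out′ y ≡ not (out P y)
    flipped {y} e = cong (_xor out P y) e

    kept : ∀ {y} → S y ≡ false → out′ y ≡ out P y
    kept {y} e = cong (_xor out P y) e

    touched-vertex : ∀ {y} → S y ≡ true → vtx G y ≡ wht w ⊎ vtx G y ≡ blk b₁ ⊎ vtx G y ≡ blk b₂
    touched-vertex {y} h with S⇒ {y} h
    ... | inj₁ refl               = inj₁ x₁-at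
    ... | inj₂ (inj₁ refl)        = inj₂ (inj₁ b₁-end)
    ... | inj₂ (inj₂ (inj₁ refl)) = inj₁ x₂-at
    ... | inj₂ (inj₂ (inj₂ refl)) = inj₂ (inj₂ b₂-end)

    untouched : ∀ {y} → vtx G y ≢ wht w → vtx G y ≢ blk b₁ → vtx G y ≢ blk b₂ → S y ≡ false
    untouched {y} ¬w ¬b₁ ¬b₂ = ¬-not λ h → [ ¬w , [ ¬b₁ , ¬b₂ ]′ ]′ (touched-vertex {y} h)

    untouched-black : ∀ {y b} → vtx G y ≡ blk b → b ≢ b₁ → b ≢ b₂ → S y ≡ false
    untouched-black e b≢b₁ b≢b₂ =
      untouched (λ e′ → contradiction (trans (sym e) e′) λ ())
                (b≢b₁ ∘ blk-injective ∘ trans (sym e)) (b≢b₂ ∘ blk-injective ∘ trans (sym e))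

    untouched-at-w : ∀ {y} → vtx G y ≡ wht w → y ≢ x₁ → y ≢ x₂ → S y ≡ false
    untouched-at-w {y} e ¬x₁ ¬x₂ = ¬-not λ h → excluded (S⇒ {y} h)
      where
      excluded : y ≡ x₁ ⊎ y ≡ α G x₁ ⊎ y ≡ x₂ ⊎ y ≡ α G x₂ → ⊥
      excluded (inj₁ e₁)               = ¬x₁ e₁
      excluded (inj₂ (inj₁ refl))      = contradiction (trans (sym e) b₁-end) λ ()
      excluded (inj₂ (inj₂ (inj₁ e₂))) = ¬x₂ e₂
      excluded (inj₂ (inj₂ (inj₂ refl))) = contradiction (trans (sym e) b₂-end) λ ()

    untouched-at-b : ∀ {y b} → vtx G y ≡ blk b → y ≢ α G x₁ → y ≢ α G x₂ → S y ≡ false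
    untouched-at-b {y} e ¬αx₁ ¬αx₂ = ¬-not λ h → excluded (S⇒ {y} h)
      where
      excluded : y ≡ x₁ ⊎ y ≡ α G x₁ ⊎ y ≡ x₂ ⊎ y ≡ α G x₂ → ⊥
      excluded (inj₁ refl)               = contradiction (trans (sym e) x₁-at) λ ()
      excluded (inj₂ (inj₁ e₁))          = ¬αx₁ e₁
      excluded (inj₂ (inj₂ (inj₁ refl))) = contradiction (trans (sym e) x₂-at) λ ()
      excluded (inj₂ (inj₂ (inj₂ e₂)))   = ¬αx₂ e₂

    αx₁-out : out P (α G x₁) ≡ true
    αx₁-out = out-α≡ P x₁-in

    out′-x₁ : out′ x₁ ≡ true
    out′-x₁ = trans (flipped {x₁} (S⇐ (inj₁ refl))) (cong not x₁-in)

    out′-x₂ : out′ x₂ ≡ false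
    out′-x₂ = trans (flipped {x₂} (S⇐ (inj₂ (inj₂ (inj₁ refl))))) (cong not x₂-out)

    out′-αx₁ : out′ (α G x₁) ≡ false
    out′-αx₁ = trans (flipped {α G x₁} (S⇐ (inj₂ (inj₁ refl)))) (cong not αx₁-out)

    out′-αx₂ : out′ (α G x₂) ≡ true
    out′-αx₂ = trans (flipped {α G x₂} (S⇐ (inj₂ (inj₂ (inj₂ refl))))) (cong not (out-α≡ P x₂-out))

    b₁-quiet : ∀ y → vtx G y ≡ blk b₁ → out′ y ≡ false
    b₁-quiet y e with toSum (y ≟F α G x₁)
    ... | inj₁ refl = out′-αx₁
    ... | inj₂ ¬αx₁ =
      trans (kept (untouched-at-b e ¬αx₁ ¬αx₂)) (¬-not λ oy → ¬αx₁ (out-unique P e b₁-end oy αx₁-out))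
      where
      ¬αx₂ : y ≢ α G x₂
      ¬αx₂ refl = b₁≢b₂ (blk-injective (trans (sym e) b₂-end))

    b₁-sink′ : T (isSink G out′ b₁)
    b₁-sink′ = isSink⇐ b₁-quiet

    out-α′ : ∀ y → out′ (α G y) ≡ not (out′ y)
    out-α′ y = trans (cong₂ _xor_ (swivelSet-α y) (out-α P y)) (sym (not-distribʳ-xor (S y) (out P y)))

    out-bnd′ : ∀ i → out′ (bdart G i) ≡ true
    out-bnd′ i = trans (kept (untouched (off λ ()) (off λ ()) (off λ ()))) (out-bnd P i)
      where
      off : ∀ {v} → bnd i ≢ v → vtx G (bdart G i) ≢ v
      off ¬v = ¬v ∘ trans (sym (bdart-v G i))

    white-in′ : ∀ w′ → count (λ y → sameVtx (vtx G y) (wht w′) ∧ not (out′ y)) ≡ 1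
    white-in′ w′ with w′ ≟F w
    ... | yes refl = AtVertex.one-at (vtx G) (wht w) x₂ x₂-at (cong not out′-x₂) others
      where
      others : ∀ y → vtx G y ≡ wht w → y ≢ x₂ → not (out′ y) ≡ false
      others y e ¬x₂ with toSum (y ≟F x₁)
      ... | inj₁ refl = cong not out′-x₁
      ... | inj₂ ¬x₁  = cong not (trans (kept (untouched-at-w e ¬x₁ ¬x₂))
                                       (¬-not λ iny → ¬x₁ (in-unique P e x₁-at iny x₁-in)))
    ... | no w′≢w = trans (AtVertex.count-at-cong (vtx G) (wht w′) λ y e → cong not (kept (elsewhere e)))
                          (white-in P w′)
      where
      elsewhere : ∀ {y} → vtx G y ≡ wht w′ → S y ≡ false
      elsewhere e = untouched (w′≢w ∘ wht-injective ∘ trans (sym e))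
                              (λ e′ → contradiction (trans (sym e) e′) λ ())
                              (λ e′ → contradiction (trans (sym e) e′) λ ())

    module _ (b₂-sink : T (isSink G (out P) b₂)) where

      black-out′ : ∀ b → count (λ y → sameVtx (vtx G y) (blk b) ∧ out′ y) ≤ 1
      black-out′ b with b ≟F b₁ | b ≟F b₂
      ... | yes refl | _ = subst (_≤ 1) (sym (AtVertex.none-at⇐ (vtx G) (blk b₁) b₁-quiet)) z≤n
      ... | no _ | yes refl = ≤-reflexive (AtVertex.one-at (vtx G) (blk b₂) (α G x₂) b₂-end out′-αx₂ others)
        where
        others : ∀ y → vtx G y ≡ blk b₂ → y ≢ α G x₂ → out′ y ≡ false
        others y e ¬αx₂ = trans (kept (untouched-at-b e ¬αx₁ ¬αx₂)) (isSink⇒ b₂-sink y e)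
          where
          ¬αx₁ : y ≢ α G x₁
          ¬αx₁ refl = b₁≢b₂ (blk-injective (trans (sym b₁-end) e))
      ... | no b≢b₁ | no b≢b₂ =
        ≤-trans (≤-reflexive (AtVertex.count-at-cong (vtx G) (blk b) λ y e →
                                kept (untouched-black e b≢b₁ b≢b₂)))
                (black-out P b)

      sink-kept : ∀ {b} → b ≢ b₂ → T (isSink G (out P) b) → T (isSink G out′ b)
      sink-kept {b} b≢b₂ s with b ≟F b₁
      ... | yes refl = b₁-sink′
      ... | no b≢b₁  = isSink⇐ λ y e → trans (kept (untouched-black e b≢b₁ b≢b₂)) (isSink⇒ s y e)

      sink-restored : ∀ {b} → b ≢ b₁ → T (isSink G out′ b) → T (isSink G (out P) b)
      sink-restored {b} b≢b₁ s with b ≟F b₂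
      ... | yes refl = b₂-sink
      ... | no b≢b₂  = isSink⇐ λ y e → trans (sym (kept (untouched-black e b≢b₁ b≢b₂))) (isSink⇒ s y e)

      reaches-w : Reaches G out′ (wht w)
      reaches-w = step x₁ (wht w) x₁-at out′-x₁ (subst (Reaches G out′) (sym b₁-end) (here b₁ b₁-sink′))

      reach′ : ∀ {v} → Reaches G (out P) v → Reaches G out′ v
      reach′ (here b s) with b ≟F b₂
      ... | yes refl = step (α G x₂) (blk b₂) b₂-end out′-αx₂
                         (subst (Reaches G out′) (sym (trans (cong (vtx G) (α-invol G x₂)) x₂-at)) reaches-w)
      ... | no b≢b₂  = here b (sink-kept b≢b₂ s)
      reach′ (step x v e ox r) with S x in t
      ... | false = step x v e (trans (kept t) ox) (reach′ r)
      ... | true with S⇒ {x} t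
      ...   | inj₁ refl               = contradiction x₁-in (≡true⇒≢false ox)
      ...   | inj₂ (inj₁ refl)        = subst (Reaches G out′) (trans (sym b₁-end) e) (here b₁ b₁-sink′)
      ...   | inj₂ (inj₂ (inj₁ refl)) = subst (Reaches G out′) (trans (sym x₂-at) e) reaches-w
      ...   | inj₂ (inj₂ (inj₂ refl)) = contradiction (out-α≡ P x₂-out) (≡true⇒≢false ox)

      toOld : Sink G out′ → Sink G (out P)
      toOld (b , s) with b ≟F b₁
      ... | yes _    = b₂ , b₂-sink
      ... | no b≢b₁  = b , sink-restored b≢b₁ s

      toNew : Sink G (out P) → Sink G out′
      toNew (b , s) with b ≟F b₂
      ... | yes _    = b₁ , b₁-sink′
      ... | no b≢b₂  = b , sink-kept b≢b₂ s

      b₁-not-sink : ¬ T (isSink G (out P) b₁)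
      b₁-not-sink s = contradiction (isSink⇒ s (α G x₁) b₁-end) (≡true⇒≢false αx₁-out)

      b₂-not-sink′ : ¬ T (isSink G out′ b₂)
      b₂-not-sink′ s = contradiction (isSink⇒ s (α G x₂) b₂-end) (≡true⇒≢false out′-αx₂)

      toOld-toNew : ∀ s → toOld (toNew s) ≡ s
      toOld-toNew (b , s) with b ≟F b₂
      ... | yes refl with b₁ ≟F b₁
      ...   | yes _   = sink-≡ refl
      ...   | no ¬b₁  = contradiction refl ¬b₁
      toOld-toNew (b , s) | no b≢b₂ with b ≟F b₁
      ...   | yes refl = contradiction s b₁-not-sink
      ...   | no _     = sink-≡ refl

      toNew-toOld : ∀ s → toNew (toOld s) ≡ s
      toNew-toOld (b , s) with b ≟F b₁
      ... | yes refl with b₂ ≟F b₂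
      ...   | yes _   = sink-≡ refl
      ...   | no ¬b₂  = contradiction refl ¬b₂
      toNew-toOld (b , s) | no b≢b₁ with b ≟F b₂
      ...   | yes refl = contradiction s b₂-not-sink′
      ...   | no _     = sink-≡ refl

      swivelled : PerfectOrientation G d
      swivelled = record
        { out       = out′
        ; out-α     = out-α′
        ; out-bnd   = out-bnd′
        ; white-in  = white-in′
        ; black-out = black-out′
        ; reach     = λ v → reach′ (reach P v)
        ; label     = label P ⤖-∘ ↔⇒⤖ (mk↔ₛ′ toOld toNew toOld-toNew toNew-toOld)
        }

      toOld-b₁ : ∀ s → proj₁ (toOld (b₁ , s)) ≡ b₂
      toOld-b₁ s with b₁ ≟F b₁
      ... | yes _  = refl
      ... | no ¬b₁ = contradiction refl ¬b₁

      toOld-other : ∀ {b} s → b ≢ b₁ → proj₁ (toOld (b , s)) ≡ b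
      toOld-other {b} s b≢b₁ with b ≟F b₁
      ... | yes e = contradiction e b≢b₁
      ... | no _  = refl

      swivel : Swivel G P swivelled
      swivel = w , x₁ , x₂ , x₁-at , x₂-at , x₁-in , x₂-out
             , (λ e → b₁≢b₂ (blk-injective (trans (sym b₁-end) (trans e b₂-end))))
             , (λ y → sym (if-not≡xor (S y) (out P y)))
             , labels
        where
        labels : ∀ c₁ c₂ → vtx G (α G x₁) ≡ blk c₁ → vtx G (α G x₂) ≡ blk c₂ →
                 (∀ p q → labelOf G swivelled (c₁ , p) ≡ labelOf G P (c₂ , q)) ×
                 (∀ b → b ≢ c₁ → ∀ p q → labelOf G swivelled (b , p) ≡ labelOf G P (b , q))
        labels c₁ c₂ e₁ e₂ with blk-injective (trans (sym e₁) b₁-end) | blk-injective (trans (sym e₂) b₂-end)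
        ... | refl | refl = (λ p q → cong (labelOf G P) (sink-≡ (toOld-b₁ p)))
                          , (λ b b≢b₁ p q → cong (labelOf G P) (sink-≡ (toOld-other p b≢b₁)))

  _≐_ : ∀ {d} → PerfectOrientation G d → PerfectOrientation G d → Set
  _≐_ = SameOrientation G

  swivel-out : ∀ {d} {P Q : PerfectOrientation G d} ((_ , x₁ , x₂ , _) : Swivel G P Q) →
               ∀ y → out Q y ≡ swivelSet x₁ x₂ y xor out P y
  swivel-out {P = P} (_ , x₁ , x₂ , _ , _ , _ , _ , _ , flips , _) y =
    trans (flips y) (if-not≡xor (swivelSet x₁ x₂ y) (out P y))

  swivel-reverse : ∀ {d} {P Q P′ : PerfectOrientation G d} → Swivel G P Q → P′ ≐ Q →
                   Σ (PerfectOrientation G d) λ Q′ → Swivel G P′ Q′ × Q′ ≐ P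
  swivel-reverse {P = P} {Q} {P′} sw@(w , x₁ , x₂ , x₁-at , x₂-at , x₁-in , x₂-out , ends≢ , _) P′≐Q
    with white-end x₁-at | white-end x₂-at
  ... | b₁ , b₁-end | b₂ , b₂-end = Back.swivelled b₁-sink′ , Back.swivel b₁-sink′ , undone
    where
    b₁≢b₂ : b₁ ≢ b₂
    b₁≢b₂ refl = ends≢ (trans b₁-end (sym b₂-end))
    module Forth = SwivelToSink P x₁-at x₂-at x₁-in x₂-out b₁-end b₂-end b₁≢b₂
    out-P′ : ∀ y → out P′ y ≡ swivelSet x₁ x₂ y xor out P y
    out-P′ y = trans (P′≐Q y) (swivel-out {P = P} {Q} sw y)
    b₁-sink′ : T (isSink G (out P′) b₁)
    b₁-sink′ = isSink⇐ {out P′} λ y e → trans (out-P′ y) (Forth.b₁-quiet y e)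
    module Back = SwivelToSink P′ x₂-at x₁-at
      (trans (out-P′ x₂) Forth.out′-x₂) (trans (out-P′ x₁) Forth.out′-x₁) b₂-end b₁-end (b₁≢b₂ ∘ sym)
    undone : Back.swivelled b₁-sink′ ≐ P
    undone y = begin
      swivelSet x₂ x₁ y xor out P′ y                      ≡⟨ cong₂ _xor_ (swivelSet-comm x₂ x₁ y) (out-P′ y) ⟩
      swivelSet x₁ x₂ y xor (swivelSet x₁ x₂ y xor out P y) ≡⟨ xor-cancelˡ (swivelSet x₁ x₂ y) (out P y) ⟩
      out P y                                             ∎
      where open ≡-Reasoning

  star-reverse : ∀ {d} {P Q P′ : PerfectOrientation G d} → Star (Swivel G) P Q → P′ ≐ Q →
                 Σ (PerfectOrientation G d) λ Q′ → Star (Swivel G) P′ Q′ × Q′ ≐ P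
  star-reverse ε P′≐Q = _ , ε , P′≐Q
  star-reverse {P = P} (_◅_ {j = P₁} sw sws) P′≐Q with star-reverse sws P′≐Q
  ... | R , P′→R , R≐ with swivel-reverse {P = P} {P₁} {R} sw R≐
  ...   | R′ , R→R′ , R′≐ = R′ , P′→R ◅◅ (R→R′ ◅ ε) , R′≐

  record Hop (b b′ : Black) : Set where
    field
      w     : White
      x y   : Dart
      x-at  : vtx G x ≡ blk b
      αx-at : vtx G (α G x) ≡ wht w
      y-at  : vtx G y ≡ wht w
      αy-at : vtx G (α G y) ≡ blk b′

  infixr 5 _▸_
  data Path : Black → Set where
    stop : ∀ b → Path b
    _▸_  : ∀ {b b′} → Hop b b′ → Path b′ → Path b

  blacks : ∀ {b} → Path b → List Black
  blacks (stop b)      = b ∷ []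
  blacks {b} (_ ▸ p)   = b ∷ blacks p

  later : ∀ {b} → Path b → List Black
  later (stop _) = []
  later (_ ▸ p)  = blacks p

  blacks≡∷later : ∀ {b} (p : Path b) → blacks p ≡ b ∷ later p
  blacks≡∷later (stop _) = refl
  blacks≡∷later (_ ▸ _)  = refl

  Simple : ∀ {b} → Path b → Set
  Simple (stop _)    = ⊤
  Simple {b} (_ ▸ p) = b ∉ blacks p × Simple p

  Directed : (Dart → Bool) → ∀ {b} → Path b → Set
  Directed o (stop b) = T (isSink G o b)
  Directed o (h ▸ p)  = o (Hop.x h) ≡ true × o (Hop.y h) ≡ true × Directed o p

  hopSet : ∀ {b b′} → Hop b b′ → Dart → Bool
  hopSet h = swivelSet (α G (Hop.x h)) (Hop.y h)

  darts : ∀ {b} → Path b → Dart → Bool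
  darts (stop _) z = false
  darts (h ▸ p)  z = hopSet h z xor darts p z

  head∉later : ∀ {b} (p : Path b) → Simple p → b ∉ later p
  head∉later (stop _) _       ()
  head∉later (_ ▸ _)  (b∉ , _) = b∉

  head∈blacks : ∀ {b} (p : Path b) → b ∈ blacks p
  head∈blacks p rewrite blacks≡∷later p = here refl

  blackEnd : Dart → Vtx n (B G) (W G)
  blackEnd z = blackEndOf (vtx G z) (vtx G (α G z))

  -- For a perfect orientation o: whether the edge of z points away from its black end.
  leaves : (Dart → Bool) → Dart → Bool
  leaves o z = isWhite (vtx G z) xor o z

  module _ {d} (P : PerfectOrientation G d) where

    -- The darts of a hop b → w → b′ are those on the edge leaving b and those on the edge entering b′,
    -- so on a simple path darts of different hops have different sides.
    Side : Dart → Bool → Black → Set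
    Side z s c = leaves (out P) z ≡ s × blackEnd z ≡ blk c

    side-unique : ∀ {z s s′ c c′} → Side z s c → Side z s′ c′ → s ≡ s′ × c ≡ c′
    side-unique (l , e) (l′ , e′) = trans (sym l) l′ , blk-injective (trans (sym e) e′)

    black-side : ∀ {z s c} → vtx G z ≡ blk c → out P z ≡ s → Side z s c
    black-side e o rewrite e = o , refl

    white-side : ∀ {z s w c} → vtx G z ≡ wht w → vtx G (α G z) ≡ blk c → out P z ≡ not s → Side z s c
    white-side {s = s} e eα o rewrite e | eα = trans (cong not o) (not-involutive s) , refl

    hop-sides : ∀ {b b′ z} (h : Hop b b′) → out P (Hop.x h) ≡ true → out P (Hop.y h) ≡ true →
                hopSet h z ≡ true → Side z true b ⊎ Side z false b′
    hop-sides {b} {b′} {z} h ox oy hz = sides (swivelSet⇒ {α G x} {y} {z} hz)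
      where
      open Hop h
      ααx-at : vtx G (α G (α G x)) ≡ blk b
      ααx-at = trans (cong (vtx G) (α-invol G x)) x-at
      sides : ∀ {u} → u ≡ α G x ⊎ u ≡ α G (α G x) ⊎ u ≡ y ⊎ u ≡ α G y → Side u true b ⊎ Side u false b′
      sides (inj₁ refl)               = inj₁ (white-side αx-at ααx-at (out-α≡ P ox))
      sides (inj₂ (inj₁ refl))        = inj₁ (black-side ααx-at (trans (cong (out P) (α-invol G x)) ox))
      sides (inj₂ (inj₂ (inj₁ refl))) = inj₂ (white-side y-at αy-at oy)
      sides (inj₂ (inj₂ (inj₂ refl))) = inj₂ (black-side αy-at (out-α≡ P oy))

    path-sides : ∀ {c z} (p : Path c) → Directed (out P) p → darts p z ≡ true →
                 Any (Side z true) (blacks p) ⊎ Any (Side z false) (later p)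
    path-sides {z = z} (h ▸ p) (ox , oy , dir) dz with xor≡true⇒ {hopSet h z} dz
    ... | inj₁ hz with hop-sides h ox oy hz
    ...   | inj₁ side = inj₁ (here side)
    ...   | inj₂ side = inj₂ (subst (Any _) (sym (blacks≡∷later p)) (here side))
    path-sides (h ▸ p) (ox , oy , dir) dz | inj₂ pz with path-sides p dir pz
    ...   | inj₁ sides = inj₁ (there sides)
    ...   | inj₂ sides = inj₂ (subst (Any _) (sym (blacks≡∷later p)) (there sides))

    hop-avoids : ∀ {b b′ z} (h : Hop b b′) (p : Path b′) → out P (Hop.x h) ≡ true → out P (Hop.y h) ≡ true →
                 Directed (out P) p → b ∉ blacks p → b′ ∉ later p → hopSet h z ≡ true → darts p z ≡ false
    hop-avoids {b} {b′} {z} h p ox oy dir b∉ b′∉ hz =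
      ¬-not λ pz → clash (hop-sides h ox oy hz) (path-sides p dir pz)
      where
      clash : Side z true b ⊎ Side z false b′ → Any (Side z true) (blacks p) ⊎ Any (Side z false) (later p) → ⊥
      clash (inj₁ side) (inj₁ sides) = b∉ (Any.map (λ side′ → proj₂ (side-unique side side′)) sides)
      clash (inj₁ side) (inj₂ sides) = true≢false (proj₁ (side-unique side (proj₂ (Any.satisfied sides))))
      clash (inj₂ side) (inj₁ sides) = true≢false (proj₁ (side-unique (proj₂ (Any.satisfied sides)) side))
      clash (inj₂ side) (inj₂ sides) = b′∉ (Any.map (λ side′ → proj₂ (side-unique side side′)) sides)

    -- Reverse the tail first; its start b′ is then a sink, and a swivel at w moves the sink back to b.
    reverse-path : ∀ {b} (p : Path b) → Simple p → Directed (out P) p →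
                   Σ (PerfectOrientation G d) λ P′ → Star (Swivel G) P P′ ×
                     (∀ z → out P′ z ≡ darts p z xor out P z) × T (isSink G (out P′) b)
    reverse-path (stop b) _ sink = P , ε , (λ _ → refl) , sink
    reverse-path {b} (_▸_ {b′ = b′} h p) (b∉ , simple) (ox , oy , dir) with reverse-path p simple dir
    ... | P₁ , P→P₁ , out-P₁ , b′-sink =
      Step.swivelled b′-sink , P→P₁ ◅◅ (Step.swivel b′-sink ◅ ε) , out-P₂ , Step.b₁-sink′
      where
      open Hop h
      kept-by-p : ∀ {z} → hopSet h z ≡ true → out P₁ z ≡ out P z
      kept-by-p {z} hz =
        trans (out-P₁ z) (cong (_xor out P z) (hop-avoids h p ox oy dir b∉ (head∉later p simple) hz))
      b≢b′ : b ≢ b′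
      b≢b′ refl = b∉ (head∈blacks p)
      module Step = SwivelToSink P₁ αx-at y-at
        (trans (kept-by-p (swivelSet⇐ {α G x} {y} {α G x} (inj₁ refl))) (out-α≡ P ox))
        (trans (kept-by-p (swivelSet⇐ {α G x} {y} {y} (inj₂ (inj₂ (inj₁ refl))))) oy)
        (trans (cong (vtx G) (α-invol G x)) x-at) αy-at b≢b′
      out-P₂ : ∀ z → hopSet h z xor out P₁ z ≡ (hopSet h z xor darts p z) xor out P z
      out-P₂ z = trans (cong (hopSet h z xor_) (out-P₁ z)) (sym (xor-assoc (hopSet h z) (darts p z) (out P z)))

    mutual
      path-from-black : ∀ {v} → Reaches G (out P) v → ∀ {b} → v ≡ blk b → Σ (Path b) (Directed (out P))
      path-from-black (here b sink) refl = stop b , sink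
      path-from-black (step x _ x-at ox r) {b} v≡b with black-out-end P (trans x-at v≡b) ox
      ... | w , αx-at with path-from-white r αx-at
      ...   | y , y-at , oy , b′ , αy-at , p , dir =
        record { w = w ; x = x ; y = y ; x-at = trans x-at v≡b ; αx-at = αx-at ; y-at = y-at ; αy-at = αy-at }
          ▸ p ,
        ox , oy , dir

      path-from-white : ∀ {v} → Reaches G (out P) v → ∀ {w} → v ≡ wht w →
                        Σ Dart λ y → vtx G y ≡ wht w × out P y ≡ true ×
                          Σ Black λ b′ → vtx G (α G y) ≡ blk b′ × Σ (Path b′) (Directed (out P))
      path-from-white (step y _ y-at oy r) v≡w with white-end (trans y-at v≡w)
      ... | b′ , αy-at = y , trans y-at v≡w , oy , b′ , αy-at , path-from-black r αy-at

  module _ {o : Dart → Bool} where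
    open import Data.List.Membership.DecPropositional (_≟F_ {B G}) using (_∈?_)

    suffix : ∀ {c b} (p : Path c) → b ∈ blacks p → Directed o p → Simple p →
             Σ (Path b) λ q → Directed o q × Simple q
    suffix (stop _) (here refl) dir simple = stop _ , dir , simple
    suffix (h ▸ p)  (here refl) dir simple = h ▸ p , dir , simple
    suffix (h ▸ p)  (there b∈) (_ , _ , dir) (_ , simple) = suffix p b∈ dir simple

    erase-loops : ∀ {b} (p : Path b) → Directed o p → Σ (Path b) λ q → Directed o q × Simple q
    erase-loops (stop b) dir = stop b , dir , tt
    erase-loops {b} (h ▸ p) (ox , oy , dir) with erase-loops p dir
    ... | q , dir′ , simple with b ∈? blacks q
    ...   | yes b∈ = suffix q b∈ dir′ simple
    ...   | no b∉  = h ▸ q , (ox , oy , dir′) , (b∉ , simple)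

  outs-agree : ∀ {d} {P Q : PerfectOrientation G d} {c} (p : Path c) → Directed (out P) p → Directed (out Q) p →
               ∀ {b z} → b ∈ blacks p → vtx G z ≡ blk b → out Q z ≡ true → out P z ≡ true
  outs-agree {Q = Q} (stop _) _ Q-sink (here refl) z-at Qz =
    contradiction (isSink⇒ {out Q} Q-sink _ z-at) (≡true⇒≢false Qz)
  outs-agree {P = P} {Q} (h ▸ _) (Px , _) (Qx , _) (here refl) z-at Qz =
    subst (λ u → out P u ≡ true) (out-unique Q (Hop.x-at h) z-at Qx Qz) Px
  outs-agree {P = P} {Q} (_ ▸ p) (_ , _ , dirP) (_ , _ , dirQ) (there b∈) =
    outs-agree {P = P} {Q} p dirP dirQ b∈

  δ : ∀ {d} → PerfectOrientation G d → PerfectOrientation G d → ℕ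
  δ P Q = count (λ z → out P z xor out Q z)

  δ-sym : ∀ {d} (P Q : PerfectOrientation G d) → δ P Q ≡ δ Q P
  δ-sym P Q = count-cong λ z → xor-comm (out P z) (out Q z)

  Progress : ∀ {d} → PerfectOrientation G d → PerfectOrientation G d → Set
  Progress {d} P Q = Σ (PerfectOrientation G d) λ P₁ → Σ (PerfectOrientation G d) λ Q₁ →
                     Star (Swivel G) P P₁ × Star (Swivel G) Q Q₁ × δ P₁ Q₁ < δ P Q

  reversals-progress : ∀ {d} (P Q : PerfectOrientation G d) {b c} (p : Path b) (q : Path c) →
                       Simple p → Directed (out P) p → Simple q → Directed (out Q) q →
                       (∀ z → darts p z xor darts q z ≡ true → out P z xor out Q z ≡ true) →
                       ∀ a → darts p a xor darts q a ≡ true → Progress P Q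
  reversals-progress P Q p q simple-p dir-p simple-q dir-q inside a flips-a
    with reverse-path P p simple-p dir-p | reverse-path Q q simple-q dir-q
  ... | P₁ , P→P₁ , out-P₁ , _ | Q₁ , Q→Q₁ , out-Q₁ , _ =
    P₁ , Q₁ , P→P₁ , Q→Q₁ ,
    count-flips-< {p = out P} {out Q} {s₁ = darts p} {s₂ = darts q} out-P₁ out-Q₁ inside a flips-a

  module _ {d} (P Q : PerfectOrientation G d) where

    differs-α : ∀ {z} → out P z xor out Q z ≡ true → out P (α G z) xor out Q (α G z) ≡ true
    differs-α {z} e =
      trans (cong₂ _xor_ (out-α P z) (out-α Q z)) (trans (xor-annihilates-not (out P z) (out Q z)) e)

    differs-edge : ∀ {a z} → out P a xor out Q a ≡ true → z ≡ a ⊎ z ≡ α G a → out P z xor out Q z ≡ true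
    differs-edge e (inj₁ refl) = e
    differs-edge e (inj₂ refl) = differs-α e

    sink-progress : ∀ {b} → T (isSink G (out P) b) → ¬ T (isSink G (out Q) b) →
                    Σ (PerfectOrientation G d) λ P₁ → Swivel G P P₁ × δ P₁ Q < δ P Q
    sink-progress {b} P-sink ¬Q-sink with AtVertex.some-at (vtx G) (blk b) (¬Q-sink ∘ ≡⇒≡ᵇ _ 0)
    ... | y , y-at , Qy with black-out-end Q y-at Qy
    ... | w , αy-at with in-at P w
    ... | x₁ , x₁-at , x₁-in with white-end x₁-at
    ... | b₁ , b₁-end = Step.swivelled P-sink , Step.swivel P-sink , shrinks
      where
      Py : out P y ≡ false
      Py = isSink⇒ P-sink y y-at
      b₁≢b : b₁ ≢ b
      b₁≢b refl = contradiction (isSink⇒ P-sink (α G x₁) b₁-end) (≡true⇒≢false (out-α≡ P x₁-in))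
      module Step = SwivelToSink P x₁-at αy-at x₁-in (out-α≡ P Py) b₁-end
                                 (trans (cong (vtx G) (α-invol G y)) y-at) b₁≢b
      Qx₁ : out Q x₁ ≡ true
      Qx₁ = ¬-not λ Qx₁-in → ≡true⇒≢false (out-α≡ P Py)
              (trans (cong (out P) (sym (in-unique Q x₁-at αy-at Qx₁-in (out-α≡ Q Qy)))) x₁-in)
      differs : ∀ z → swivelSet x₁ (α G y) z xor false ≡ true → out P z xor out Q z ≡ true
      differs z h with swivelSet⇒ {x₁} {α G y} {z} (trans (sym (xor-identityʳ _)) h)
      ... | inj₁ z≡        = differs-edge (cong₂ _xor_ x₁-in Qx₁) (inj₁ z≡)
      ... | inj₂ (inj₁ z≡) = differs-edge (cong₂ _xor_ x₁-in Qx₁) (inj₂ z≡)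
      ... | inj₂ (inj₂ z≡) = differs-edge (differs-α (cong₂ _xor_ Py Qy)) z≡
      shrinks : δ (Step.swivelled P-sink) Q < δ P Q
      shrinks = count-flips-< {p = out P} {out Q} {s₁ = swivelSet x₁ (α G y)} {s₂ = λ _ → false}
                  (λ _ → refl) (λ _ → refl) differs (α G y)
                  (trans (xor-identityʳ _) (swivelSet⇐ {x₁} {α G y} {α G y} (inj₂ (inj₂ (inj₁ refl)))))

    black-witness : ∀ {u} → out P u ≡ true → out Q u ≡ false →
                    Σ Black λ c → Σ Dart λ u′ → vtx G u′ ≡ blk c × out P u′ ≡ true × out Q u′ ≡ false
    black-witness {u} Pu Qu with vtx G u in u-at
    ... | blk c = c , u , u-at , Pu , Qu
    ... | bnd _ = contradiction Qu (≡true⇒≢false (out-at-bnd Q u-at))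
    ... | wht w with in-at P w
    ...   | xin , xin-at , xin-in with white-end xin-at
    ...     | c , c-end = c , α G xin , c-end , out-α≡ P xin-in , out-α≡ Q Qxin
      where
      Qxin : out Q xin ≡ true
      Qxin = ¬-not λ Qxin-in →
        ≡true⇒≢false Pu (trans (cong (out P) (sym (in-unique Q xin-at u-at Qxin-in Qu))) xin-in)

    differing-black-out : ∀ {z} → out P z ≢ out Q z →
                          Σ Black λ c → Σ Dart λ u → vtx G u ≡ blk c × out P u ≡ true × out Q u ≡ false
    differing-black-out {z} z≢ with out P z in Pz | out Q z in Qz
    ... | true  | false = black-witness Pz Qz
    ... | false | true  = black-witness (out-α≡ P Pz) (out-α≡ Q Qz)
    ... | true  | true  = contradiction refl z≢
    ... | false | false = contradiction refl z≢

  record Divergence {d} (P Q : PerfectOrientation G d) : Set where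
    field
      {b t}         : Black
      hop           : Hop b t
      rest          : Path t
      simple        : Simple (hop ▸ rest)
      x-out         : out P (Hop.x hop) ≡ true
      y-out         : out P (Hop.y hop) ≡ true
      rest-directed : Directed (out P) rest
      x-flipped     : out Q (Hop.x hop) ≡ false
      y-kept        : out Q (Hop.y hop) ≡ true
      rest-kept     : Directed (out Q) rest

  module SameSinks {d} (P Q : PerfectOrientation G d)
                   (same-sinks : ∀ b → isSink G (out P) b ≡ isSink G (out Q) b) where

    entry-kept : ∀ {b t} (h : Hop b t) (p : Path t) → out P (Hop.y h) ≡ true →
                 Directed (out P) p → Directed (out Q) p → out Q (Hop.y h) ≡ true
    entry-kept h p Py dirP dirQ = ¬-not λ Qy →
      ≡true⇒≢false (outs-agree {P = P} {Q} p dirP dirQ (head∈blacks p) (Hop.αy-at h) (out-α≡ Q Qy))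
                   (out-α≡ P Py)

    last-divergence : ∀ {c} (p : Path c) → Simple p → Directed (out P) p → Directed (out Q) p ⊎ Divergence P Q
    last-divergence (stop c) _ P-sink = inj₁ (subst T (same-sinks c) P-sink)
    last-divergence (h ▸ p) simple (Px , Py , dirP) with last-divergence p (proj₂ simple) dirP
    ... | inj₂ div  = inj₂ div
    ... | inj₁ dirQ with out Q (Hop.x h) in Qx
    ...   | true  = inj₁ (refl , entry-kept h p Py dirP dirQ , dirQ)
    ...   | false = inj₂ record { hop = h ; rest = p ; simple = simple
                                ; x-out = Px ; y-out = Py ; rest-directed = dirP
                                ; x-flipped = Qx ; y-kept = entry-kept h p Py dirP dirQ ; rest-kept = dirQ }

    divergence-progress : Divergence P Q → Progress P Q
    divergence-progress div with in-at Q (Hop.w (Divergence.hop div))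
    ... | xd , xd-at , xd-in with white-end xd-at
    ... | d′ , d′-end =
      reversals-progress P Q (hop ▸ rest) (hopQ ▸ rest) simple (x-out , y-out , rest-directed)
                         (d′∉ , proj₂ simple) (out-α≡ Q xd-in , y-kept , rest-kept) inside (α G x) flips-αx
      where
      open Divergence div
      open Hop hop
      Pxd : out P xd ≡ true
      Pxd = ¬-not λ Pxd-in → ≡true⇒≢false (out-α≡ Q x-flipped)
              (trans (cong (out Q) (in-unique P αx-at xd-at (out-α≡ P x-out) Pxd-in)) xd-in)
      hopQ : Hop d′ t
      hopQ = record { w = w ; x = α G xd ; y = y ; x-at = d′-end
                    ; αx-at = trans (cong (vtx G) (α-invol G xd)) xd-at ; y-at = y-at ; αy-at = αy-at }
      d′∉ : d′ ∉ blacks rest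
      d′∉ d′∈ = ≡true⇒≢false (outs-agree {P = P} {Q} rest rest-directed rest-kept d′∈ d′-end (out-α≡ Q xd-in))
                              (out-α≡ P Pxd)
      shared : ∀ z → darts (hop ▸ rest) z xor darts (hopQ ▸ rest) z ≡ hopSet hop z xor hopSet hopQ z
      shared z = xor-cancel-common (hopSet hop z) (hopSet hopQ z) (darts rest z)
      inside : ∀ z → darts (hop ▸ rest) z xor darts (hopQ ▸ rest) z ≡ true → out P z xor out Q z ≡ true
      inside z h with swivelSet-shared {α G x} {α G (α G xd)} {y} {z} (trans (sym (shared z)) h)
      ... | inj₁ z∈ = differs-edge P Q (differs-α P Q (cong₂ _xor_ x-out x-flipped)) z∈
      ... | inj₂ z∈ = differs-edge P Q (differs-α P Q (differs-α P Q (cong₂ _xor_ Pxd xd-in))) z∈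
      αx∉hopQ : hopSet hopQ (α G x) ≡ false
      αx∉hopQ = ¬-not λ h → excluded (swivelSet⇒ {α G (α G xd)} {y} {α G x} h)
        where
        excluded : α G x ≡ α G (α G xd) ⊎ α G x ≡ α G (α G (α G xd)) ⊎ α G x ≡ y ⊎ α G x ≡ α G y → ⊥
        excluded (inj₁ e) = ≡true⇒≢false (trans (cong (out P) (sym (α-injective e))) x-out) (out-α≡ P Pxd)
        excluded (inj₂ (inj₁ e)) =
          contradiction (trans (sym x-at) (trans (cong (vtx G) (trans (α-injective e) (α-invol G xd))) xd-at)) λ ()
        excluded (inj₂ (inj₂ (inj₁ e))) = ≡true⇒≢false (trans (cong (out P) e) y-out) (out-α≡ P x-out)
        excluded (inj₂ (inj₂ (inj₂ e))) =
          contradiction (trans (sym x-at) (trans (cong (vtx G) (α-injective e)) y-at)) λ ()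
      flips-αx : darts (hop ▸ rest) (α G x) xor darts (hopQ ▸ rest) (α G x) ≡ true
      flips-αx = trans (shared (α G x)) (cong₂ _xor_ (swivelSet⇐ {α G x} {y} {α G x} (inj₁ refl)) αx∉hopQ)

    same-sinks-progress : ∀ {z} → out P z ≢ out Q z → Progress P Q
    same-sinks-progress z≢ with differing-black-out P Q z≢
    ... | c , u , u-at , Pu , Qu with path-from-black P (reach P (blk c)) refl
    ... | p₀ , dir₀ with erase-loops p₀ dir₀
    ... | p , dir , simple with last-divergence p simple dir
    ... | inj₂ div  = divergence-progress div
    ... | inj₁ dirQ =
      contradiction Qu (≡true⇒≢false (outs-agree {P = Q} {P} p dirQ dir (head∈blacks p) u-at Pu))

  progress : ∀ {d} (P Q : PerfectOrientation G d) {z} → out P z ≢ out Q z → Progress P Q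
  progress P Q z≢ = by-sinks (all? sinks?)
    where
    sinks? : ∀ b → Dec (isSink G (out P) b ≡ isSink G (out Q) b)
    sinks? b = isSink G (out P) b ≟B isSink G (out Q) b

    swivel-P : (Σ (PerfectOrientation G _) λ P₁ → Swivel G P P₁ × δ P₁ Q < δ P Q) → Progress P Q
    swivel-P (P₁ , sw , shrinks) = P₁ , Q , sw ◅ ε , ε , shrinks

    swivel-Q : (Σ (PerfectOrientation G _) λ Q₁ → Swivel G Q Q₁ × δ Q₁ P < δ Q P) → Progress P Q
    swivel-Q (Q₁ , sw , shrinks) = P , Q₁ , ε , sw ◅ ε , subst₂ _<_ (δ-sym Q₁ P) (δ-sym Q P) shrinks

    by-sink : ∀ {b} → (T (isSink G (out P) b) × ¬ T (isSink G (out Q) b)) ⊎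
                      (¬ T (isSink G (out P) b) × T (isSink G (out Q) b)) → Progress P Q
    by-sink {b} (inj₁ (P-sink , ¬Q-sink)) = swivel-P (sink-progress P Q {b} P-sink ¬Q-sink)
    by-sink {b} (inj₂ (¬P-sink , Q-sink)) = swivel-Q (sink-progress Q P {b} Q-sink ¬P-sink)

    by-sinks : Dec (∀ b → isSink G (out P) b ≡ isSink G (out Q) b) → Progress P Q
    by-sinks (yes same) = SameSinks.same-sinks-progress P Q same z≢
    by-sinks (no ¬same) = by-sink (bools-differ (proj₂ (¬∀⟶∃¬ (B G) _ sinks? ¬same)))

  swivel-connected : ∀ {d} (P Q : PerfectOrientation G d) →
                     Σ (PerfectOrientation G d) λ R → Star (Swivel G) P R × R ≐ Q
  swivel-connected P Q = connect P Q (<-wellFounded (δ P Q))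
    where
    connect : ∀ {d} (P Q : PerfectOrientation G d) → Acc _<_ (δ P Q) →
              Σ (PerfectOrientation G d) λ R → Star (Swivel G) P R × R ≐ Q
    connect P Q (acc smaller) with all? (λ z → out P z ≟B out Q z)
    ... | yes P≐Q = P , ε , P≐Q
    ... | no P≉Q with progress P Q (proj₂ (¬∀⟶∃¬ _ _ (λ z → out P z ≟B out Q z) P≉Q))
    ...   | P₁ , Q₁ , P→P₁ , Q→Q₁ , shrinks with connect P₁ Q₁ (smaller shrinks)
    ...     | R₁ , P₁→R₁ , R₁≐Q₁ with star-reverse Q→Q₁ R₁≐Q₁
    ...       | R , R₁→R , R≐Q = R , P→P₁ ◅◅ P₁→R₁ ◅◅ R₁→R , R≐Q

mainTheorem10 : ∀ {n d : ℕ} (G : PlabicGraph n) → AugmentedWeb G d →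
    (P Q : PerfectOrientation G d) →
    Σ (PerfectOrientation G d) λ R →
    Star (Swivel G) P R × SameOrientation G R Q
mainTheorem10 G _ = Swivels.swivel-connected G
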